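{- Let $n\ge 1$ and let $x_1\ge x_2\ge\dots\ge x_n$ be positive integers with $\sum_{i=1}^n 2^{ -x_i}\ge 1$. Then there exists a family $\mathcal{L}=\{L_i\}_{i\in[n]}$ of sets of positive integers with $|L_i|=x_i$ for every $i\in[n]$ such that the discrete interval hypergraph $H_n$ does not admit a unique-maximum coloring from $\mathcal{L}$.
   Context: $[n]=\{1,\dots,n\}$; for $s\le t$ in $[n]$, $[s,t]=\{i: s\le i\le t\}$. The discrete interval hypergraph $H_n$ has vertex set $[n]$ and hyperedges all $[s,t]$ with $s\le t$, $s,t\in[n]$. A coloring $C\colon[n]\to\mathbb{Z}_{>0}$ is a unique-maximum coloring if in every hyperedge the maximum color appears on exactly one vertex; it is from $\mathcal{L}$ if $C(i)\in L_i$ for all $i$. -}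

module Defs where

open import Data.Nat using (ℕ; zero; suc; _≤_; _<_)
open import Data.Fin using (Fin; toℕ)
open import Data.List using (List; foldr; allFin; map)
open import Data.Product using (∃; _×_)
open import Relation.Binary.PropositionalEquality using (_≡_)
open import Relation.Nullary using (¬_)
open import Data.Rational using (ℚ; 1ℚ; ½; _*_; _+_; 0ℚ)

inv2^ : ℕ → ℚ
inv2^ zero    = 1ℚ
inv2^ (suc k) = ½ * inv2^ k

sumFin : (n : ℕ) → (Fin n → ℚ) → ℚ
sumFin n f = foldr _+_ 0ℚ (map f (allFin n))

InInterval : {n : ℕ} → Fin n → Fin n → Fin n → Set
InInterval s t i = toℕ s ≤ toℕ i × toℕ i ≤ toℕ t

UniqueMaxOn : {n : ℕ} → (Fin n → ℕ) → Fin n → Fin n → Set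
UniqueMaxOn {n} C s t =
  ∃ λ k → InInterval s t k ×
    ((j : Fin n) → InInterval s t j → ¬ (j ≡ k) → C j < C k)

-- unique-maximum coloring of the discrete interval hypergraph H_n
IsUniqueMaxColoring : (n : ℕ) → (Fin n → ℕ) → Set
IsUniqueMaxColoring n C =
  (s t : Fin n) → toℕ s ≤ toℕ t → UniqueMaxOn C s t

-- Give vertex i the list of the x i colours K − x i + 1, …, K, where K = x 1 is the largest length,
-- and put e i = K − x i, so that every admissible colour satisfies e i < C i ≤ K and e is
-- nondecreasing along the path. For any unique-maximum colouring of a segment whose colours are at
-- most c one shows Σ 2^(e i) < 2^c by induction on the segment: split it at its maximum k, with
-- C k = c′ + 1 ≤ c; both sides have colours at most c′, so each contributes less than 2^c′, and
-- the right-hand side is divisible by 2^(e k) because e is nondecreasing, hence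
-- 2^(e k) + (right-hand side) ≤ 2^c′. Taking c = K gives Σ 2^(−x i) < 1.
module Submission where

open import Defs
open import Data.Nat
  using (ℕ; zero; suc; pred; _+_; _*_; _∸_; _^_; _≤_; _<_; z≤n; s≤s; s≤s⁻¹; z<s; _<?_; >-nonZero)
open import Data.Nat.Properties
open import Data.Nat.Divisibility using (_∣_; divides; ∣m∣n⇒∣m+n; m∣m*n)
open import Data.Nat.Induction using (<-rec)
open import Data.Fin using (Fin; zero; suc; toℕ; fromℕ<)
open import Data.Fin.Properties using (toℕ<n; fromℕ<-toℕ; toℕ-fromℕ<)
open import Data.List using (List; length; foldr; map; allFin; applyUpTo)
open import Data.List.Properties using (map-cong; map-tabulate; length-applyUpTo)
open import Data.List.Relation.Unary.All as All using (All)
open import Data.List.Relation.Unary.Unique.Propositional using (Unique)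
open import Data.List.Relation.Unary.Unique.Propositional.Properties using (applyUpTo⁺₁)
open import Data.List.Membership.Propositional using (_∈_)
open import Data.List.Membership.Propositional.Properties using (∈-applyUpTo⁻)
open import Data.Product using (Σ; ∃; ∃₂; _×_; _,_; proj₁; proj₂)
open import Function using (_∘_)
open import Relation.Binary.PropositionalEquality
open import Relation.Nullary using (¬_; yes; no; contradiction)
open import Data.Rational using (ℚ; 0ℚ; 1ℚ; ½; nonNegative)
  renaming (_+_ to _+ℚ_; _*_ to _*ℚ_; _≤_ to _≤ℚ_; _<_ to _<ℚ_)
import Data.Rational.Properties as ℚ

sumFrom : (ℕ → ℕ) → ℕ → ℕ → ℕ
sumFrom f s zero    = 0
sumFrom f s (suc l) = f s + sumFrom f (suc s) l

sumFrom-∘suc : ∀ f s l → sumFrom (f ∘ suc) s l ≡ sumFrom f (suc s) l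
sumFrom-∘suc f s zero    = refl
sumFrom-∘suc f s (suc l) = cong (f (suc s) +_) (sumFrom-∘suc f (suc s) l)

sumFrom-+ : ∀ f s a b → sumFrom f s (a + b) ≡ sumFrom f s a + sumFrom f (s + a) b
sumFrom-+ f s zero    b = cong (λ s′ → sumFrom f s′ b) (sym (+-identityʳ s))
sumFrom-+ f s (suc a) b = begin
  f s + sumFrom f (suc s) (a + b)                   ≡⟨ cong (f s +_) (sumFrom-+ f (suc s) a b) ⟩
  f s + (sumFrom f (suc s) a + sumFrom f (suc s + a) b) ≡⟨ +-assoc (f s) _ _ ⟨
  left + sumFrom f (suc s + a) b                       ≡⟨ cong (λ s′ → left + sumFrom f s′ b) (+-suc s a) ⟨
  left + sumFrom f (s + suc a) b                       ∎
  where
  open ≡-Reasoning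
  left = f s + sumFrom f (suc s) a

sumFrom-pivot : ∀ f s a r →
  sumFrom f s (suc (a + r)) ≡ sumFrom f s a + (f (s + a) + sumFrom f (suc (s + a)) r)
sumFrom-pivot f s a r = begin
  sumFrom f s (suc (a + r))                 ≡⟨ cong (sumFrom f s) (+-suc a r) ⟨
  sumFrom f s (a + suc r)                   ≡⟨ sumFrom-+ f s a (suc r) ⟩
  sumFrom f s a + sumFrom f (s + a) (suc r) ∎
  where open ≡-Reasoning

sumFrom-∣ : ∀ {d} f s l → (∀ i → s ≤ i → i < s + l → d ∣ f i) → d ∣ sumFrom f s l
sumFrom-∣ f s zero    _   = divides 0 refl
sumFrom-∣ f s (suc l) d∣f = ∣m∣n⇒∣m+n (d∣f s ≤-refl (m<m+n s z<s))
  (sumFrom-∣ f (suc s) l λ i s<i i<s+l → d∣f i (<⇒≤ s<i) (subst (i <_) (sym (+-suc s l)) i<s+l))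

2^-∣ : ∀ {m n} → m ≤ n → 2 ^ m ∣ 2 ^ n
2^-∣ {m} {n} m≤n = subst (λ k → 2 ^ m ∣ 2 ^ k) (m+[n∸m]≡n m≤n)
  (subst (2 ^ m ∣_) (sym (^-distribˡ-+-* 2 m (n ∸ m))) (m∣m*n (2 ^ (n ∸ m))))

d∣m⇒d∣n⇒m<n⇒m+d≤n : ∀ {d m n} → d ∣ m → d ∣ n → m < n → m + d ≤ n
d∣m⇒d∣n⇒m<n⇒m+d≤n {d} (divides p refl) (divides q refl) pd<qd =
  subst (_≤ q * d) (+-comm d (p * d)) (*-monoˡ-≤ d (*-cancelʳ-< d p q pd<qd))

2^m+2^m≤2^n : ∀ {m n} → m < n → 2 ^ m + 2 ^ m ≤ 2 ^ n
2^m+2^m≤2^n {m} {n} m<n = subst (_≤ 2 ^ n) (cong (2 ^ m +_) (+-identityʳ (2 ^ m))) (^-monoʳ-≤ 2 m<n)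

decompose : ∀ {s k l} → s ≤ k → k ≤ s + l → ∃₂ λ a r → k ≡ s + a × l ≡ a + r
decompose {s} {k} {l} s≤k k≤s+l with m≤n⇒∃[o]m+o≡n s≤k
... | a , refl with m≤n⇒∃[o]m+o≡n (+-cancelˡ-≤ s a l k≤s+l)
...   | r , a+r≡l = a , r , refl , sym a+r≡l

UniqueMaxBetween : (ℕ → ℕ) → ℕ → ℕ → Set
UniqueMaxBetween C s t = ∃ λ k → s ≤ k × k ≤ t × (∀ j → s ≤ j → j ≤ t → j ≢ k → C j < C k)

module WeightBound (n : ℕ) (C e : ℕ → ℕ)
  (unique-max : ∀ s t → s ≤ t → t < n → UniqueMaxBetween C s t)
  (e-mono : ∀ i j → i ≤ j → j < n → e i ≤ e j)
  (e<C : ∀ i → i < n → e i < C i) where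

  weight : ℕ → ℕ
  weight i = 2 ^ e i

  BoundedSegments : ℕ → Set
  BoundedSegments l = ∀ s c → s + l ≤ n → (∀ i → s ≤ i → i < s + l → C i ≤ c) →
    sumFrom weight s l < 2 ^ c

  boundedSegments : ∀ l → BoundedSegments l
  boundedSegments = <-rec BoundedSegments step
    where
    step : ∀ l → (∀ {l′} → l′ < l → BoundedSegments l′) → BoundedSegments l
    step zero    _   s c _ _ = m^n>0 2 c
    step (suc l) rec s c s+l<n C≤c
      with unique-max s (s + l) (m≤m+n s l) (subst (_≤ n) (+-suc s l) s+l<n)
    ... | k , s≤k , k≤s+l , C<Ck with decompose s≤k k≤s+l
    ... | a , r , refl , refl = begin-strict
      sumFrom weight s (suc (a + r))                        ≡⟨ sumFrom-pivot weight s a r ⟩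
      sumFrom weight s a + (weight k + sumFrom weight k+1 r) <⟨ +-mono-<-≤ left pivot+right≤2^c′ ⟩
      2 ^ c′ + 2 ^ c′                                      ≤⟨ 2^m+2^m≤2^n c′<c ⟩
      2 ^ c                                                ∎
      where
      open ≤-Reasoning
      k+1 = suc k
      t = s + (a + r)
      k≤t : k ≤ t
      k≤t = +-monoʳ-≤ s (m≤m+n a r)
      t<n : t < n
      t<n = subst (_≤ n) (+-suc s (a + r)) s+l<n
      k<n : k < n
      k<n = ≤-<-trans k≤t t<n
      k+1+r≡1+t : k+1 + r ≡ suc t
      k+1+r≡1+t = cong suc (+-assoc s a r)
      k+1+r≤n : k+1 + r ≤ n
      k+1+r≤n = subst (_≤ n) (sym k+1+r≡1+t) t<n
      c′ = pred (C k)
      c′<c : c′ < c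
      c′<c = subst (_≤ c) (sym (suc-pred (C k) {{>-nonZero (m<n⇒0<n (e<C k k<n))}}))
        (C≤c k s≤k (subst (k <_) (sym (+-suc s (a + r))) (s≤s k≤t)))
      C≤c′ : ∀ j → s ≤ j → j ≤ t → j ≢ k → C j ≤ c′
      C≤c′ j s≤j j≤t j≢k = <⇒≤pred (C<Ck j s≤j j≤t j≢k)
      left : sumFrom weight s a < 2 ^ c′
      left = rec (s≤s (m≤m+n a r)) s c′ (<⇒≤ k<n) λ i s≤i i<k →
        C≤c′ i s≤i (≤-trans (<⇒≤ i<k) k≤t) (<⇒≢ i<k)
      right : sumFrom weight k+1 r < 2 ^ c′
      right = rec (s≤s (m≤n+m r a)) k+1 c′ k+1+r≤n λ i k<i i<k+1+r →
        C≤c′ i (≤-trans s≤k (<⇒≤ k<i)) (s≤s⁻¹ (subst (i <_) k+1+r≡1+t i<k+1+r)) (≢-sym (<⇒≢ k<i))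
      weight-k∣right : weight k ∣ sumFrom weight k+1 r
      weight-k∣right = sumFrom-∣ weight k+1 r λ i k<i i<k+1+r →
        2^-∣ (e-mono k i (<⇒≤ k<i) (<-≤-trans i<k+1+r k+1+r≤n))
      pivot+right≤2^c′ : weight k + sumFrom weight k+1 r ≤ 2 ^ c′
      pivot+right≤2^c′ = subst (_≤ 2 ^ c′) (+-comm (sumFrom weight k+1 r) (weight k))
        (d∣m⇒d∣n⇒m<n⇒m+d≤n weight-k∣right (2^-∣ (<⇒≤pred (e<C k k<n))) right)

extend : ∀ {n} → (Fin n → ℕ) → ℕ → ℕ
extend {n} f j with j <? n
... | yes j<n = f (fromℕ< j<n)
... | no  _   = 0

extend-toℕ : ∀ {n} (f : Fin n → ℕ) i → extend f (toℕ i) ≡ f i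
extend-toℕ {n} f i with toℕ i <? n
... | yes i<n = cong f (fromℕ<-toℕ i i<n)
... | no  i≮n = contradiction (toℕ<n i) i≮n

toℕ-onto : ∀ {n j} → j < n → ∃ λ (i : Fin n) → toℕ i ≡ j
toℕ-onto j<n = fromℕ< j<n , toℕ-fromℕ< j<n

uniqueMaxOn-extend : ∀ {n} {C : Fin n → ℕ} {s t} → UniqueMaxOn C s t →
  UniqueMaxBetween (extend C) (toℕ s) (toℕ t)
uniqueMaxOn-extend {n} {C} {s} {t} (k , (s≤k , k≤t) , C<Ck) = toℕ k , s≤k , k≤t , C<Ck′
  where
  C<Ck′ : ∀ j → toℕ s ≤ j → j ≤ toℕ t → j ≢ toℕ k → extend C j < extend C (toℕ k)
  C<Ck′ j s≤j j≤t j≢k with toℕ-onto (≤-<-trans j≤t (toℕ<n t))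
  ... | j′ , refl rewrite extend-toℕ C j′ | extend-toℕ C k =
    C<Ck j′ (s≤j , j≤t) (j≢k ∘ cong toℕ)

weightSum<2^c : ∀ {n} (C e : Fin n → ℕ) c → IsUniqueMaxColoring n C →
  (∀ i j → toℕ i ≤ toℕ j → e i ≤ e j) → (∀ i → e i < C i) → (∀ i → C i ≤ c) →
  sumFrom (λ j → 2 ^ extend e j) 0 n < 2 ^ c
weightSum<2^c {n} C e c unique-max e-mono e<C C≤c =
  WeightBound.boundedSegments n (extend C) (extend e) unique-maxℕ e-monoℕ e<Cℕ n 0 c ≤-refl C≤cℕ
  where
  unique-maxℕ : ∀ s t → s ≤ t → t < n → UniqueMaxBetween (extend C) s t
  unique-maxℕ s t s≤t t<n with toℕ-onto (≤-<-trans s≤t t<n) | toℕ-onto t<n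
  ... | s′ , refl | t′ , refl = uniqueMaxOn-extend (unique-max s′ t′ s≤t)
  e-monoℕ : ∀ i j → i ≤ j → j < n → extend e i ≤ extend e j
  e-monoℕ i j i≤j j<n with toℕ-onto (≤-<-trans i≤j j<n) | toℕ-onto j<n
  ... | i′ , refl | j′ , refl rewrite extend-toℕ e i′ | extend-toℕ e j′ = e-mono i′ j′ i≤j
  e<Cℕ : ∀ i → i < n → extend e i < extend C i
  e<Cℕ i i<n with toℕ-onto i<n
  ... | i′ , refl rewrite extend-toℕ e i′ | extend-toℕ C i′ = e<C i′
  C≤cℕ : ∀ i → 0 ≤ i → i < n → extend C i ≤ c
  C≤cℕ i _ i<n with toℕ-onto i<n
  ... | i′ , refl rewrite extend-toℕ C i′ = C≤c i′

toℚ : ℕ → ℚ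
toℚ zero    = 0ℚ
toℚ (suc m) = 1ℚ +ℚ toℚ m

toℚ-+ : ∀ m n → toℚ (m + n) ≡ toℚ m +ℚ toℚ n
toℚ-+ zero    n = sym (ℚ.+-identityˡ (toℚ n))
toℚ-+ (suc m) n = trans (cong (1ℚ +ℚ_) (toℚ-+ m n)) (sym (ℚ.+-assoc 1ℚ (toℚ m) (toℚ n)))

toℚ-nonNeg : ∀ m → 0ℚ ≤ℚ toℚ m
toℚ-nonNeg zero    = ℚ.≤-refl
toℚ-nonNeg (suc m) = ℚ.+-mono-≤ (ℚ.nonNegative⁻¹ 1ℚ) (toℚ-nonNeg m)

toℚ-mono-< : ∀ {m n} → m < n → toℚ m <ℚ toℚ n
toℚ-mono-< {zero}  {suc n} _          = ℚ.+-mono-<-≤ (ℚ.positive⁻¹ 1ℚ) (toℚ-nonNeg n)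
toℚ-mono-< {suc m} {suc n} (s≤s m<n) = ℚ.+-monoʳ-< 1ℚ (toℚ-mono-< m<n)

toℚ-cancel-≤ : ∀ {m n} → toℚ m ≤ℚ toℚ n → m ≤ n
toℚ-cancel-≤ m≤n = ≮⇒≥ λ n<m → ℚ.<-irrefl refl (ℚ.≤-<-trans m≤n (toℚ-mono-< n<m))

½*p*[q+q]≡p*q : ∀ p q → (½ *ℚ p) *ℚ (q +ℚ q) ≡ p *ℚ q
½*p*[q+q]≡p*q p q = begin
  (½ *ℚ p) *ℚ (q +ℚ q)                 ≡⟨ ℚ.*-distribˡ-+ (½ *ℚ p) q q ⟩
  (½ *ℚ p) *ℚ q +ℚ (½ *ℚ p) *ℚ q       ≡⟨ ℚ.*-distribʳ-+ q (½ *ℚ p) (½ *ℚ p) ⟨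
  (½ *ℚ p +ℚ ½ *ℚ p) *ℚ q             ≡⟨ cong (_*ℚ q) (ℚ.*-distribʳ-+ p ½ ½) ⟨
  -- ½ +ℚ ½ computes to 1ℚ
  ((½ +ℚ ½) *ℚ p) *ℚ q                ≡⟨ cong (_*ℚ q) (ℚ.*-identityˡ p) ⟩
  p *ℚ q                               ∎
  where open ≡-Reasoning

inv2^-*-2^ : ∀ {k K} → k ≤ K → inv2^ k *ℚ toℚ (2 ^ K) ≡ toℚ (2 ^ (K ∸ k))
inv2^-*-2^ {zero}  {K}     _         = ℚ.*-identityˡ (toℚ (2 ^ K))
inv2^-*-2^ {suc k} {suc K} (s≤s k≤K) = begin
  (½ *ℚ inv2^ k) *ℚ toℚ (2^K + (2^K + 0))   ≡⟨ cong (λ m → (½ *ℚ inv2^ k) *ℚ toℚ (2^K + m)) (+-identityʳ 2^K) ⟩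
  (½ *ℚ inv2^ k) *ℚ toℚ (2^K + 2^K)         ≡⟨ cong ((½ *ℚ inv2^ k) *ℚ_) (toℚ-+ 2^K 2^K) ⟩
  (½ *ℚ inv2^ k) *ℚ (toℚ 2^K +ℚ toℚ 2^K)    ≡⟨ ½*p*[q+q]≡p*q (inv2^ k) (toℚ 2^K) ⟩
  inv2^ k *ℚ toℚ 2^K                        ≡⟨ inv2^-*-2^ k≤K ⟩
  toℚ (2 ^ (K ∸ k))                         ∎
  where
  open ≡-Reasoning
  2^K = 2 ^ K

sumFin-suc : ∀ n (f : Fin (suc n) → ℚ) → sumFin (suc n) f ≡ f zero +ℚ sumFin n (f ∘ suc)
sumFin-suc n f = cong (λ fs → f zero +ℚ foldr _+ℚ_ 0ℚ fs)
  (trans (map-tabulate suc f) (sym (map-tabulate (λ i → i) (f ∘ suc))))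

sumFin-cong : ∀ n {f g : Fin n → ℚ} → (∀ i → f i ≡ g i) → sumFin n f ≡ sumFin n g
sumFin-cong n f≗g = cong (foldr _+ℚ_ 0ℚ) (map-cong f≗g (allFin n))

sumFin-*ʳ : ∀ n (f : Fin n → ℚ) q → sumFin n f *ℚ q ≡ sumFin n (λ i → f i *ℚ q)
sumFin-*ʳ zero    f q = ℚ.*-zeroˡ q
sumFin-*ʳ (suc n) f q = begin
  sumFin (suc n) f *ℚ q                          ≡⟨ cong (_*ℚ q) (sumFin-suc n f) ⟩
  (f zero +ℚ sumFin n (f ∘ suc)) *ℚ q            ≡⟨ ℚ.*-distribʳ-+ q (f zero) _ ⟩
  f zero *ℚ q +ℚ sumFin n (f ∘ suc) *ℚ q         ≡⟨ cong (f zero *ℚ q +ℚ_) (sumFin-*ʳ n (f ∘ suc) q) ⟩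
  f zero *ℚ q +ℚ sumFin n (λ i → f (suc i) *ℚ q) ≡⟨ sumFin-suc n (λ i → f i *ℚ q) ⟨
  sumFin (suc n) (λ i → f i *ℚ q)                ∎
  where open ≡-Reasoning

sumFin-toℚ : ∀ n (f : ℕ → ℕ) → sumFin n (λ i → toℚ (f (toℕ i))) ≡ toℚ (sumFrom f 0 n)
sumFin-toℚ zero    f = refl
sumFin-toℚ (suc n) f = begin
  sumFin (suc n) (λ i → toℚ (f (toℕ i)))              ≡⟨ sumFin-suc n (λ i → toℚ (f (toℕ i))) ⟩
  toℚ (f 0) +ℚ sumFin n (λ i → toℚ (f (suc (toℕ i)))) ≡⟨ cong (toℚ (f 0) +ℚ_) (sumFin-toℚ n (f ∘ suc)) ⟩
  toℚ (f 0) +ℚ toℚ (sumFrom (f ∘ suc) 0 n)           ≡⟨ cong (λ m → toℚ (f 0) +ℚ toℚ m) (sumFrom-∘suc f 0 n) ⟩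
  toℚ (f 0) +ℚ toℚ (sumFrom f 1 n)                   ≡⟨ toℚ-+ (f 0) (sumFrom f 1 n) ⟨
  toℚ (sumFrom f 0 (suc n))                          ∎
  where open ≡-Reasoning

scaledKraftSum≥2^K : ∀ {n} (x : Fin n → ℕ) K → (∀ i → x i ≤ K) →
  1ℚ ≤ℚ sumFin n (λ i → inv2^ (x i)) → 2 ^ K ≤ sumFrom (λ j → 2 ^ extend (λ i → K ∸ x i) j) 0 n
scaledKraftSum≥2^K {n} x K x≤K 1≤Σ = toℚ-cancel-≤ (begin
  P                                    ≡⟨ ℚ.*-identityˡ P ⟨
  1ℚ *ℚ P                              ≤⟨ ℚ.*-monoʳ-≤-nonNeg P {{nonNegative (toℚ-nonNeg (2 ^ K))}} 1≤Σ ⟩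
  sumFin n (λ i → inv2^ (x i)) *ℚ P    ≡⟨ sumFin-*ʳ n _ P ⟩
  sumFin n (λ i → inv2^ (x i) *ℚ P)    ≡⟨ sumFin-cong n scale ⟩
  sumFin n (λ i → toℚ (w (toℕ i)))     ≡⟨ sumFin-toℚ n w ⟩
  toℚ (sumFrom w 0 n)                  ∎)
  where
  open ℚ.≤-Reasoning
  P = toℚ (2 ^ K)
  e : Fin n → ℕ
  e i = K ∸ x i
  w : ℕ → ℕ
  w j = 2 ^ extend e j
  scale : ∀ i → inv2^ (x i) *ℚ P ≡ toℚ (w (toℕ i))
  scale i = trans (inv2^-*-2^ (x≤K i)) (cong (λ m → toℚ (2 ^ m)) (sym (extend-toℕ e i)))

rangeAbove : ℕ → ℕ → List ℕ
rangeAbove a b = applyUpTo (λ d → suc (a + d)) b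

rangeAbove-unique : ∀ a b → Unique (rangeAbove a b)
rangeAbove-unique a b = applyUpTo⁺₁ _ b λ d<d′ _ eq → <⇒≢ d<d′ (+-cancelˡ-≡ a _ _ (suc-injective eq))

length-rangeAbove : ∀ a b → length (rangeAbove a b) ≡ b
length-rangeAbove a b = length-applyUpTo _ b

∈-rangeAbove⁻ : ∀ {a b c} → c ∈ rangeAbove a b → a < c × c ≤ a + b
∈-rangeAbove⁻ {a} {b} c∈ with ∈-applyUpTo⁻ _ c∈
... | d , d<b , refl = s≤s (m≤m+n a d) , subst (_≤ a + b) (+-suc a d) (+-monoʳ-≤ a d<b)

rangeAbove-positive : ∀ a b → All (λ c → 1 ≤ c) (rangeAbove a b)
rangeAbove-positive a b = All.tabulate λ c∈ → m<n⇒0<n (proj₁ (∈-rangeAbove⁻ c∈))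

mainTheorem4 : (n : ℕ) → 1 ≤ n → (x : Fin n → ℕ)
    → ((i : Fin n) → 1 ≤ x i)
    → ((i j : Fin n) → toℕ i ≤ toℕ j → x j ≤ x i)
    → 1ℚ ≤ℚ sumFin n (λ i → inv2^ (x i))
    → Σ (Fin n → List ℕ) λ L →
        ((i : Fin n) → Unique (L i) × All (λ c → 1 ≤ c) (L i) × length (L i) ≡ x i)
        × ((C : Fin n → ℕ) → ((i : Fin n) → C i ∈ L i) → ¬ IsUniqueMaxColoring n C)
mainTheorem4 zero    ()
mainTheorem4 (suc m) _ x _ x-sorted 1≤Σ = L , L-valid , no-colouring
  where
  K = x zero
  x≤K : ∀ i → x i ≤ K
  x≤K i = x-sorted zero i z≤n
  L : Fin (suc m) → List ℕ
  L i = rangeAbove (K ∸ x i) (x i)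
  L-valid : ∀ i → Unique (L i) × All (λ c → 1 ≤ c) (L i) × length (L i) ≡ x i
  L-valid i = rangeAbove-unique _ _ , rangeAbove-positive _ _ , length-rangeAbove _ _
  no-colouring : (C : Fin (suc m) → ℕ) → (∀ i → C i ∈ L i) → ¬ IsUniqueMaxColoring (suc m) C
  no-colouring C C∈L unique-max =
    <⇒≱ (weightSum<2^c C e K unique-max e-mono e<C C≤K) (scaledKraftSum≥2^K x K x≤K 1≤Σ)
    where
    e : Fin (suc m) → ℕ
    e i = K ∸ x i
    e-mono : ∀ i j → toℕ i ≤ toℕ j → e i ≤ e j
    e-mono i j i≤j = ∸-monoʳ-≤ K (x-sorted i j i≤j)
    e<C : ∀ i → e i < C i
    e<C i = proj₁ (∈-rangeAbove⁻ (C∈L i))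
    C≤K : ∀ i → C i ≤ K
    C≤K i = subst (C i ≤_) (m∸n+n≡m (x≤K i)) (proj₂ (∈-rangeAbove⁻ (C∈L i)))
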